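{- Let $k\ge2$. For every integer $N\ge1$, \[f_0(N,k)=\left\lceil \frac{N}{k}\right\rceil-1+f_0\!\left(\left\lceil \frac{N}{k}\right\rceil-1,\;k\right).\]
   Context: Fix an integer $k\ge 2$. Let $T_k$ be the infinite rooted $k$-ary tree (every vertex has exactly $k$ children) with one additional self-loop at the root, so every vertex has degree $k+1$. Chip-firing: a vertex with at least $k+1$ chips may fire, sending one chip along each incident edge (a non-root vertex sends one chip to its parent and one to each of its $k$ children; the root sends one chip to each of its $k$ children and one chip to itself along the self-loop). Starting with $N\ge 0$ chips at the root and none elsewhere, vertices fire until no vertex can fire; this terminates, and the number of times each vertex fires does not depend on the order of firings. $f_0(N,k)$ denotes the number of times the root fires (so $f_0(0,k)=0$). -}

module Defs where

open import Data.Nat using (ℕ; zero; suc; _+_; _∸_; _<_; _≤_)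
open import Data.Nat.DivMod using (_/_)
open import Data.Fin using (Fin)
import Data.Fin.Properties as FinP
open import Data.List using (List; []; _∷_; filter; length)
open import Data.List.Properties using (≡-dec)
open import Data.Product using (Σ; ∃; _×_; _,_)
open import Relation.Nullary using (Dec; yes; no)
open import Relation.Binary.PropositionalEquality using (_≡_)

-- Vertices of the infinite rooted k-ary tree: a vertex is the path from
-- the root, stored with the LAST step first.  The root is [] and the
-- children of v are  i ∷ v  for i : Fin k.
Vertex : ℕ → Set
Vertex k = List (Fin k)

_≟V_ : ∀ {k} → (v w : Vertex k) → Dec (v ≡ w)
_≟V_ = ≡-dec FinP._≟_

Config : ℕ → Set
Config k = Vertex k → ℕ

loop : ∀ {k} → Vertex k → Vertex k → ℕ
loop [] [] = 1
loop _  _  = 0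

isChild : ∀ {k} → Vertex k → Vertex k → ℕ
isChild []       y = 0
isChild (i ∷ x') y with x' ≟V y
... | yes _ = 1
... | no  _ = 0

edges : ∀ {k} → Vertex k → Vertex k → ℕ
edges v w = loop v w + isChild w v + isChild v w

-- fire vertex v once: v loses k+1 chips (its degree), and every vertex w
-- receives one chip per edge joining v and w (the root gets one back via
-- its self-loop).
fire : ∀ k → Vertex k → Config k → Config k
fire k v c w with v ≟V w
... | yes _ = (c w ∸ suc k) + edges v w
... | no  _ = c w + edges v w

data Run (k : ℕ) : Config k → List (Vertex k) → Config k → Set where
  done : ∀ {c} → Run k c [] c
  step : ∀ {c v vs c'} → suc k ≤ c v → Run k (fire k v c) vs c' → Run k c (v ∷ vs) c'

Stable : ∀ k → Config k → Set
Stable k c = ∀ v → c v < suc k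

initial : ∀ k → ℕ → Config k
initial k N []      = N
initial k N (_ ∷ _) = 0

rootCount : ∀ {k} → List (Vertex k) → ℕ
rootCount vs = length (filter (λ v → v ≟V []) vs)

-- RootFirings k N m : some legal firing sequence starting from N chips at
-- the root stabilises, with the root firing exactly m times.  (By the
-- standard termination / abelian property this m is unique and equals f₀(N,k).)
RootFirings : ℕ → ℕ → ℕ → Set
RootFirings k N m =
  Σ (List (Vertex k)) λ vs → Σ (Config k) λ c' →
    Run k (initial k N) vs c' × Stable k c' × rootCount vs ≡ m

-- ceiling division ⌈ N / k ⌉ (junk value 0 for k = 0, never used)
⌈_/_⌉ : ℕ → ℕ → ℕ
⌈ N / zero ⌉    = 0
⌈ N / suc k' ⌉  = (N + k') / suc k'

-- Write N = r + k t with 1 ≤ r ≤ k, so that t = ⌈N/k⌉ - 1.  Firing the root t times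
-- leaves r chips on it and t chips on each of its children.  From then on the subtree
-- below each child behaves like a copy of T_k started with t chips, the edge to the root
-- playing the part of the self-loop: a firing of a vertex v of T_k is simulated by firing
-- v in all k copies and, when v is the root, firing the root once more (it has just
-- received one chip from each child, and it returns one to each).  The root therefore
-- keeps r ≤ k chips, the big configuration is stable as soon as the copies are, and
-- the root has fired t + f₀(t,k) times.
--
-- That f₀ is well defined is the abelian property, obtained from the least action
-- principle: by the conservation law  c' w + (k+1)·#(firings of w) = c w + (chips sent
-- to w), no legal firing sequence fires a vertex more often than a stabilising one.

module Submission where

open import Defs
open import Data.Fin using (Fin; zero; suc)
import Data.Fin.Properties as Fin
open import Data.List using (List; []; _∷_; _++_; _∷ʳ_; [_]; map; replicate; tabulate)
open import Data.List.Properties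
  using (map-++; map-tabulate; ++-identityʳ; ++-assoc; ∷ʳ-injectiveˡ; ∷ʳ-injectiveʳ)
open import Data.List.Relation.Unary.All as All using (All; []; _∷_)
import Data.List.Relation.Unary.All.Properties as AllProperties
open import Data.List.Relation.Unary.AllPairs using ([]; _∷_)
open import Data.List.Relation.Unary.Unique.Propositional using (Unique)
import Data.List.Relation.Unary.Unique.Propositional.Properties as UniqueProperties
open import Data.List.Reverse using (reverseView; []; _∶_∶ʳ_)
open import Data.Nat using (ℕ; zero; suc; _+_; _*_; _∸_; _≤_; _<_; z≤n; s≤s; s<s⁻¹)
open import Data.Nat.DivMod using (_/_; _%_; m≡m%n+[m/n]*n; m%n<n; m/n≡1+[m∸n]/n)
open import Data.Nat.ListAction using (sum)
open import Data.Nat.ListAction.Properties using (sum-++)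
open import Data.Nat.Properties
open import Algebra.Properties.CommutativeSemigroup +-commutativeSemigroup
  using (x∙yz≈y∙xz; x∙yz≈xz∙y; xy∙z≈xz∙y)
open import Data.Product using (∃; ∃₂; _×_; _,_; map₂)
open import Function using (_∘_)
open import Function.Definitions using (Injective)
open import Relation.Binary.Definitions using (DecidableEquality)
open import Relation.Binary.PropositionalEquality hiding ([_])
open import Relation.Nullary using (yes; no; contradiction)

module _ {A : Set} where

  sum-map-++ : ∀ (f : A → ℕ) xs ys → sum (map f (xs ++ ys)) ≡ sum (map f xs) + sum (map f ys)
  sum-map-++ f xs ys = trans (cong sum (map-++ f xs ys)) (sum-++ (map f xs) (map f ys))

  sum-map-++-∷ : ∀ (f : A → ℕ) xs x ys → sum (map f (xs ++ x ∷ ys)) ≡ f x + sum (map f (xs ++ ys))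
  sum-map-++-∷ f xs x ys = begin
    sum (map f (xs ++ x ∷ ys))               ≡⟨ sum-map-++ f xs (x ∷ ys) ⟩
    sum (map f xs) + (f x + sum (map f ys))  ≡⟨ x∙yz≈y∙xz (sum (map f xs)) (f x) _ ⟩
    f x + (sum (map f xs) + sum (map f ys))  ≡⟨ cong (f x +_) (sum-map-++ f xs ys) ⟨
    f x + sum (map f (xs ++ ys))             ∎
    where open ≡-Reasoning

  sum-map-replicate : ∀ (f : A → ℕ) n x → sum (map f (replicate n x)) ≡ n * f x
  sum-map-replicate f zero    x = refl
  sum-map-replicate f (suc n) x = cong (f x +_) (sum-map-replicate f n x)

sum-tabulate-const : ∀ {n c} (f : Fin n → ℕ) → (∀ j → f j ≡ c) → sum (tabulate f) ≡ n * c
sum-tabulate-const {zero}  f f≡c = refl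
sum-tabulate-const {suc n} f f≡c = cong₂ _+_ (f≡c zero) (sum-tabulate-const (f ∘ suc) (f≡c ∘ suc))

sum-tabulate-single : ∀ {n} (f : Fin n → ℕ) i → (∀ j → j ≢ i → f j ≡ 0) → sum (tabulate f) ≡ f i
sum-tabulate-single {suc n} f zero    f≡0 = begin
  f zero + sum (tabulate (f ∘ suc))  ≡⟨ cong (f zero +_) (sum-tabulate-const (f ∘ suc) λ j → f≡0 (suc j) λ ()) ⟩
  f zero + n * 0                     ≡⟨ cong (f zero +_) (*-zeroʳ n) ⟩
  f zero + 0                         ≡⟨ +-identityʳ (f zero) ⟩
  f zero                             ∎
  where open ≡-Reasoning
sum-tabulate-single {suc n} f (suc i) f≡0 =
  cong₂ _+_ (f≡0 zero λ ())
            (sum-tabulate-single (f ∘ suc) i λ j j≢i → f≡0 (suc j) (j≢i ∘ Fin.suc-injective))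

module Multiplicity {A : Set} (_≟_ : DecidableEquality A) where

  δ : A → A → ℕ
  δ x y with x ≟ y
  ... | yes _ = 1
  ... | no  _ = 0

  count : A → List A → ℕ
  count y xs = sum (map (λ x → δ x y) xs)

  infix 4 _⊑_
  record _⊑_ (xs ys : List A) : Set where
    constructor mk⊑
    field count-≤ : ∀ z → count z xs ≤ count z ys
  open _⊑_ public

  δ-refl : ∀ x → δ x x ≡ 1
  δ-refl x with x ≟ x
  ... | yes _   = refl
  ... | no  x≢x = contradiction refl x≢x

  δ-≢ : ∀ {x y} → x ≢ y → δ x y ≡ 0
  δ-≢ {x} {y} x≢y with x ≟ y
  ... | yes x≡y = contradiction x≡y x≢y
  ... | no  _   = refl

  δ-injective : ∀ {f : A → A} → Injective _≡_ _≡_ f → ∀ x y → δ (f x) (f y) ≡ δ x y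
  δ-injective f-injective x y with x ≟ y
  ... | yes refl = δ-refl _
  ... | no  x≢y  = δ-≢ (x≢y ∘ f-injective)

  count-pos⇒split : ∀ {x} ys → 0 < count x ys → ∃₂ λ us vs → ys ≡ us ++ x ∷ vs
  count-pos⇒split {x} (y ∷ ys) pos with y ≟ x
  ... | yes refl = [] , ys , refl
  ... | no  _    with count-pos⇒split ys pos
  ...   | us , vs , refl = y ∷ us , vs , refl

  ⊑-∷ʳ : ∀ {x xs ys} → count x xs < count x ys → xs ⊑ ys → xs ∷ʳ x ⊑ ys
  ⊑-∷ʳ {x} {xs} {ys} lt xs⊑ys = mk⊑ λ z →
    subst (_≤ count z ys) (sym (sum-map-++ (λ y → δ y z) xs [ x ])) (count-∷ʳ-≤ z)
    where
    count-∷ʳ-≤ : ∀ z → count z xs + (δ x z + 0) ≤ count z ys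
    count-∷ʳ-≤ z with x ≟ z
    ... | yes refl = subst (_≤ count x ys) (+-comm 1 (count x xs)) lt
    ... | no  _    = subst (_≤ count z ys) (sym (+-identityʳ (count z xs))) (count-≤ xs⊑ys z)

  sum-map-mono-⊑ : ∀ (f : A → ℕ) {xs ys} → xs ⊑ ys → sum (map f xs) ≤ sum (map f ys)
  sum-map-mono-⊑ f {[]}     _                 = z≤n
  sum-map-mono-⊑ f {x ∷ xs} {ys} (mk⊑ x∷xs≤ys) with count-pos⇒split ys x∈ys
    where
    x∈ys : 0 < count x ys
    x∈ys = ≤-trans (subst (λ n → 1 ≤ n + count x xs) (sym (δ-refl x)) (s≤s z≤n)) (x∷xs≤ys x)
  ... | us , vs , refl = begin
    f x + sum (map f xs)          ≤⟨ +-monoʳ-≤ (f x) (sum-map-mono-⊑ f xs⊑us++vs) ⟩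
    f x + sum (map f (us ++ vs))  ≡⟨ sum-map-++-∷ f us x vs ⟨
    sum (map f (us ++ x ∷ vs))    ∎
    where
    open ≤-Reasoning
    xs⊑us++vs : xs ⊑ us ++ vs
    xs⊑us++vs = mk⊑ λ z → +-cancelˡ-≤ (δ x z) _ _
      (subst (δ x z + count z xs ≤_) (sum-map-++-∷ (λ y → δ y z) us x vs) (x∷xs≤ys z))

module _ {k : ℕ} where

  open Multiplicity (_≟V_ {k}) public

  inflow : List (Vertex k) → Vertex k → ℕ
  inflow vs w = sum (map (λ v → edges v w) vs)

  rootCount≡count : (vs : List (Vertex k)) → rootCount vs ≡ count [] vs
  rootCount≡count []       = refl
  rootCount≡count (v ∷ vs) with v ≟V []
  ... | yes _ = cong suc (rootCount≡count vs)
  ... | no  _ = rootCount≡count vs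

  run-++ : ∀ {c c₁ c₂ vs ws} → Run k c vs c₁ → Run k c₁ ws c₂ → Run k c (vs ++ ws) c₂
  run-++ done           run = run
  run-++ (step ok run₁) run = step ok (run-++ run₁ run)

  fire-balance : ∀ {c} v w → suc k ≤ c v → fire k v c w + suc k * δ v w ≡ c w + edges v w
  fire-balance {c} v w ok with v ≟V w
  ... | yes refl = begin
    (c v ∸ suc k + edges v v) + suc k * 1  ≡⟨ cong (c v ∸ suc k + edges v v +_) (*-identityʳ (suc k)) ⟩
    (c v ∸ suc k + edges v v) + suc k      ≡⟨ xy∙z≈xz∙y (c v ∸ suc k) _ _ ⟩
    (c v ∸ suc k + suc k) + edges v v      ≡⟨ cong (_+ edges v v) (m∸n+n≡m ok) ⟩
    c v + edges v v                        ∎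
    where open ≡-Reasoning
  ... | no  _    = trans (cong (c w + edges v w +_) (*-zeroʳ (suc k))) (+-identityʳ _)

  Run-conservation : ∀ {c vs c'} → Run k c vs c' → ∀ w → c' w + suc k * count w vs ≡ c w + inflow vs w
  Run-conservation {c} done w = cong (c w +_) (*-zeroʳ (suc k))
  Run-conservation {c} {v ∷ vs} {c'} (step ok run) w = begin
    c' w + K * (δ v w + count w vs)           ≡⟨ cong (c' w +_) (*-distribˡ-+ K (δ v w) (count w vs)) ⟩
    c' w + (K * δ v w + K * count w vs)       ≡⟨ x∙yz≈xz∙y (c' w) _ _ ⟩
    (c' w + K * count w vs) + K * δ v w       ≡⟨ cong (_+ K * δ v w) (Run-conservation run w) ⟩
    (fire k v c w + inflow vs w) + K * δ v w  ≡⟨ xy∙z≈xz∙y (fire k v c w) _ _ ⟩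
    (fire k v c w + K * δ v w) + inflow vs w  ≡⟨ cong (_+ inflow vs w) (fire-balance v w ok) ⟩
    (c w + edges v w) + inflow vs w           ≡⟨ +-assoc (c w) (edges v w) (inflow vs w) ⟩
    c w + (edges v w + inflow vs w)           ∎
    where
    open ≡-Reasoning
    K = suc k

  Run-conservation-at : ∀ {c vs c' w n e} → Run k c vs c' → count w vs ≡ n → inflow vs w ≡ e →
                        c' w + suc k * n ≡ c w + e
  Run-conservation-at {w = w} run refl refl = Run-conservation run w

  fire-≥-elsewhere : ∀ {c v w} → v ≢ w → c w ≤ fire k v c w
  fire-≥-elsewhere {c} {v} {w} v≢w with v ≟V w
  ... | yes v≡w = contradiction v≡w v≢w
  ... | no  _   = m≤m+n (c w) (edges v w)

  distinct-run : ∀ {c vs} → Unique vs → All (λ v → suc k ≤ c v) vs → ∃ λ c' → Run k c vs c'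
  distinct-run                 []              []         = _ , done
  distinct-run {c} {v ∷ _} (v≢vs ∷ unique) (ok ∷ oks) =
    map₂ (step ok) (distinct-run unique (All.zipWith still-ok (v≢vs , oks)))
    where
    still-ok : ∀ {w} → v ≢ w × suc k ≤ c w → suc k ≤ fire k v c w
    still-ok (v≢w , ok′) = ≤-trans ok′ (fire-≥-elsewhere v≢w)

  fire-root : ∀ {c} → suc k ≤ c [] → fire k [] c [] ≡ c [] ∸ k
  fire-root {c} ok = trans (+-comm (c [] ∸ suc k) 1) (sym (+-∸-assoc 1 ok))

  root-fires-repeatedly : ∀ s {c} → k * s < c [] → ∃ λ c' → Run k c (replicate s []) c'
  root-fires-repeatedly zero        _    = _ , done
  root-fires-repeatedly (suc s) {c} ks<c = map₂ (step ok) (root-fires-repeatedly s ks<c′)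
    where
    k+ks<c : k + k * s < c []
    k+ks<c = subst (_< c []) (*-suc k s) ks<c
    ok : suc k ≤ c []
    ok = m+n≤o⇒m≤o (suc k) k+ks<c
    ks<c′ : k * s < fire k [] c []
    ks<c′ = subst (k * s <_) (sym (fire-root {c} ok)) (begin-strict
      k * s            ≡⟨ m+n∸m≡n k (k * s) ⟨
      (k + k * s) ∸ k  <⟨ ∸-monoˡ-< k+ks<c (m≤m+n k (k * s)) ⟩
      c [] ∸ k         ∎)
      where open ≤-Reasoning

  next-firing-bounded : ∀ {c ws d p c₁ v} → Run k c ws d → Stable k d → Run k c p c₁ → p ⊑ ws →
                        suc k ≤ c₁ v → count v p < count v ws
  next-firing-bounded {c} {ws} {d} {p} {c₁} {v} run-ws stable run-p p⊑ws ok =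
    s<s⁻¹ (*-cancelˡ-< K (suc (count v p)) (suc (count v ws)) (begin-strict
      K * suc (count v p)   ≡⟨ *-suc K (count v p) ⟩
      K + K * count v p     ≤⟨ +-monoˡ-≤ (K * count v p) ok ⟩
      c₁ v + K * count v p  ≡⟨ Run-conservation run-p v ⟩
      c v + inflow p v      ≤⟨ +-monoʳ-≤ (c v) (sum-map-mono-⊑ (λ x → edges x v) p⊑ws) ⟩
      c v + inflow ws v     ≡⟨ Run-conservation run-ws v ⟨
      d v + K * count v ws  <⟨ +-monoˡ-< (K * count v ws) (stable v) ⟩
      K + K * count v ws    ≡⟨ *-suc K (count v ws) ⟨
      K * suc (count v ws)  ∎))
    where
    open ≤-Reasoning
    K = suc k

  least-action-from : ∀ {c ws d p c₁ vs c'} → Run k c ws d → Stable k d → Run k c p c₁ → p ⊑ ws →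
                      Run k c₁ vs c' → p ++ vs ⊑ ws
  least-action-from {ws = ws} {p = p} _ _ _ p⊑ws done = subst (_⊑ ws) (sym (++-identityʳ p)) p⊑ws
  least-action-from {ws = ws} {p = p} run-ws stable run-p p⊑ws (step {v = v} {vs} ok run) =
    subst (_⊑ ws) (++-assoc p [ v ] vs)
      (least-action-from run-ws stable (run-++ run-p (step ok done))
        (⊑-∷ʳ (next-firing-bounded run-ws stable run-p p⊑ws ok) p⊑ws) run)

  least-action : ∀ {c ws d vs c'} → Run k c ws d → Stable k d → Run k c vs c' → vs ⊑ ws
  least-action run-ws stable run = least-action-from run-ws stable done (mk⊑ λ _ → z≤n) run

RootFirings-unique : ∀ {k N a b} → RootFirings k N a → RootFirings k N b → a ≡ b
RootFirings-unique (vs , _ , run , stable , refl) (ws , _ , run′ , stable′ , refl) = begin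
  rootCount vs  ≡⟨ rootCount≡count vs ⟩
  count [] vs   ≡⟨ ≤-antisym (count-≤ (least-action run′ stable′ run) [])
                             (count-≤ (least-action run stable run′) []) ⟩
  count [] ws   ≡⟨ rootCount≡count ws ⟨
  rootCount ws  ∎
  where open ≡-Reasoning

module _ {k : ℕ} where

  ∷ʳ≢[] : ∀ (v : Vertex k) i → v ∷ʳ i ≢ []
  ∷ʳ≢[] []      i ()
  ∷ʳ≢[] (a ∷ v) i ()

  ∷ʳ-injective-at : (i : Fin k) → Injective _≡_ _≡_ (_∷ʳ i)
  ∷ʳ-injective-at i {u} {v} = ∷ʳ-injectiveˡ u v

  loop-∷ʳ : ∀ (v : Vertex k) i w → loop (v ∷ʳ i) w ≡ 0
  loop-∷ʳ []      i w = refl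
  loop-∷ʳ (a ∷ v) i w = refl

  isChild-∷ : ∀ (a : Fin k) x y → isChild (a ∷ x) y ≡ δ x y
  isChild-∷ a x y with x ≟V y
  ... | yes _ = refl
  ... | no  _ = refl

  isChild-∷ʳ : ∀ (u v : Vertex k) i → isChild (u ∷ʳ i) (v ∷ʳ i) ≡ isChild u v
  isChild-∷ʳ []      v i = trans (isChild-∷ i [] (v ∷ʳ i)) (δ-≢ (∷ʳ≢[] v i ∘ sym))
  isChild-∷ʳ (a ∷ u) v i = begin
    isChild (a ∷ (u ∷ʳ i)) (v ∷ʳ i)  ≡⟨ isChild-∷ a (u ∷ʳ i) (v ∷ʳ i) ⟩
    δ (u ∷ʳ i) (v ∷ʳ i)              ≡⟨ δ-injective (∷ʳ-injective-at i) u v ⟩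
    δ u v                            ≡⟨ isChild-∷ a u v ⟨
    isChild (a ∷ u) v                ∎
    where open ≡-Reasoning

  isChild-∷ʳ-≢ : ∀ (u v : Vertex k) {i j} → i ≢ j → isChild (u ∷ʳ i) (v ∷ʳ j) ≡ 0
  isChild-∷ʳ-≢ []      v {i} {j} _   = trans (isChild-∷ i [] (v ∷ʳ j)) (δ-≢ (∷ʳ≢[] v j ∘ sym))
  isChild-∷ʳ-≢ (a ∷ u) v {i} {j} i≢j =
    trans (isChild-∷ a (u ∷ʳ i) (v ∷ʳ j)) (δ-≢ (i≢j ∘ ∷ʳ-injectiveʳ u v))

  edges-∷ʳ-≢ : ∀ (v u : Vertex k) {i j} → i ≢ j → edges (v ∷ʳ i) (u ∷ʳ j) ≡ 0
  edges-∷ʳ-≢ v u {i} i≢j =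
    cong₂ _+_ (cong₂ _+_ (loop-∷ʳ v i _) (isChild-∷ʳ-≢ u v (i≢j ∘ sym))) (isChild-∷ʳ-≢ v u i≢j)

  edges-∷ʳ : ∀ (v u : Vertex k) i → edges (v ∷ʳ i) (u ∷ʳ i) + loop v u ≡ edges v u
  edges-∷ʳ v u i = begin
    edges (v ∷ʳ i) (u ∷ʳ i) + loop v u      ≡⟨ cong (_+ loop v u) edges-∷ʳ≡ ⟩
    (isChild u v + isChild v u) + loop v u  ≡⟨ +-comm _ (loop v u) ⟩
    loop v u + (isChild u v + isChild v u)  ≡⟨ +-assoc (loop v u) _ _ ⟨
    edges v u                               ∎
    where
    open ≡-Reasoning
    edges-∷ʳ≡ : edges (v ∷ʳ i) (u ∷ʳ i) ≡ isChild u v + isChild v u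
    edges-∷ʳ≡ = cong₂ _+_ (cong₂ _+_ (loop-∷ʳ v i _) (isChild-∷ʳ u v i)) (isChild-∷ʳ v u i)

  edges-∷ʳ-root : ∀ (v : Vertex k) i → edges (v ∷ʳ i) [] ≡ loop v []
  edges-∷ʳ-root []      i = refl
  edges-∷ʳ-root (a ∷ v) i = trans (isChild-∷ a (v ∷ʳ i) []) (δ-≢ (∷ʳ≢[] v i))

  edges-root-∷ʳ : ∀ (u : Vertex k) i → edges [] (u ∷ʳ i) ≡ loop [] u
  edges-root-∷ʳ []      i = refl
  edges-root-∷ʳ (a ∷ u) i = trans (+-identityʳ _) (trans (isChild-∷ a (u ∷ʳ i) []) (δ-≢ (∷ʳ≢[] u i)))

  copies : Vertex k → List (Vertex k)
  copies v = tabulate (v ∷ʳ_)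

  sum-map-copies-single : ∀ (f : Vertex k → ℕ) v i → (∀ j → j ≢ i → f (v ∷ʳ j) ≡ 0) →
                          sum (map f (copies v)) ≡ f (v ∷ʳ i)
  sum-map-copies-single f v i f≡0 =
    trans (cong sum (map-tabulate (v ∷ʳ_) f)) (sum-tabulate-single (f ∘ (v ∷ʳ_)) i f≡0)

  sum-map-copies-const : ∀ (f : Vertex k → ℕ) v {c} → (∀ j → f (v ∷ʳ j) ≡ c) →
                         sum (map f (copies v)) ≡ k * c
  sum-map-copies-const f v f≡c =
    trans (cong sum (map-tabulate (v ∷ʳ_) f)) (sum-tabulate-const (f ∘ (v ∷ʳ_)) f≡c)

  count-copies-∷ʳ : ∀ v u i → count (u ∷ʳ i) (copies v) ≡ δ v u
  count-copies-∷ʳ v u i =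
    trans (sum-map-copies-single (λ x → δ x (u ∷ʳ i)) v i (λ j j≢i → δ-≢ (j≢i ∘ ∷ʳ-injectiveʳ v u)))
          (δ-injective (∷ʳ-injective-at i) v u)

  inflow-copies-∷ʳ : ∀ v u i → inflow (copies v) (u ∷ʳ i) ≡ edges (v ∷ʳ i) (u ∷ʳ i)
  inflow-copies-∷ʳ v u i = sum-map-copies-single (λ x → edges x (u ∷ʳ i)) v i (λ j → edges-∷ʳ-≢ v u)

  count-root-after-copies : ∀ v → count [] (copies v) ≡ 0
  count-root-after-copies v = trans (sum-map-copies-const (λ x → δ x []) v (λ j → δ-≢ (∷ʳ≢[] v j))) (*-zeroʳ k)

  inflow-root-after-copies : ∀ v → inflow (copies v) [] ≡ k * loop v []
  inflow-root-after-copies v = sum-map-copies-const (λ x → edges x []) v (edges-∷ʳ-root v)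

  liftFiring : Vertex k → List (Vertex k)
  liftFiring []      = copies [] ∷ʳ []
  liftFiring (a ∷ v) = copies (a ∷ v)

  count-liftFiring-∷ʳ : ∀ v u i → count (u ∷ʳ i) (liftFiring v) ≡ δ v u
  count-liftFiring-∷ʳ []      u i = begin
    count (u ∷ʳ i) (copies [] ∷ʳ [])                  ≡⟨ sum-map-++ (λ x → δ x (u ∷ʳ i)) (copies []) [ [] ] ⟩
    count (u ∷ʳ i) (copies []) + (δ [] (u ∷ʳ i) + 0)  ≡⟨ cong₂ _+_ (count-copies-∷ʳ [] u i)
                                                                   (cong (_+ 0) (δ-≢ (∷ʳ≢[] u i ∘ sym))) ⟩
    δ [] u + 0                                        ≡⟨ +-identityʳ (δ [] u) ⟩
    δ [] u                                            ∎
    where open ≡-Reasoning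
  count-liftFiring-∷ʳ (a ∷ v) u i = count-copies-∷ʳ (a ∷ v) u i

  inflow-liftFiring-∷ʳ : ∀ v u i → inflow (liftFiring v) (u ∷ʳ i) ≡ edges v u
  inflow-liftFiring-∷ʳ []      u i = begin
    inflow (copies [] ∷ʳ []) (u ∷ʳ i)                      ≡⟨ sum-map-++ (λ x → edges x (u ∷ʳ i)) (copies []) [ [] ] ⟩
    inflow (copies []) (u ∷ʳ i) + (edges [] (u ∷ʳ i) + 0)  ≡⟨ cong₂ _+_ (inflow-copies-∷ʳ [] u i)
                                                                        (trans (+-identityʳ _) (edges-root-∷ʳ u i)) ⟩
    edges ([] ∷ʳ i) (u ∷ʳ i) + loop [] u                   ≡⟨ edges-∷ʳ [] u i ⟩
    edges [] u                                             ∎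
    where open ≡-Reasoning
  inflow-liftFiring-∷ʳ (a ∷ v) u i =
    trans (inflow-copies-∷ʳ (a ∷ v) u i) (trans (sym (+-identityʳ _)) (edges-∷ʳ (a ∷ v) u i))

  count-liftFiring-root : ∀ v → count [] (liftFiring v) ≡ δ v []
  count-liftFiring-root []      =
    trans (sum-map-++ (λ x → δ x []) (copies []) [ [] ]) (cong (_+ 1) (count-root-after-copies []))
  count-liftFiring-root (a ∷ v) = count-root-after-copies (a ∷ v)

  inflow-liftFiring-root : ∀ v → inflow (liftFiring v) [] ≡ suc k * δ v []
  inflow-liftFiring-root []      = begin
    inflow (copies [] ∷ʳ []) []  ≡⟨ sum-map-++ (λ x → edges x []) (copies []) [ [] ] ⟩
    inflow (copies []) [] + 1    ≡⟨ cong (_+ 1) (inflow-root-after-copies []) ⟩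
    k * 1 + 1                    ≡⟨ +-comm (k * 1) 1 ⟩
    suc k * 1                    ∎
    where open ≡-Reasoning
  inflow-liftFiring-root (a ∷ v) = inflow-root-after-copies (a ∷ v)

  root-after-copies : ∀ {c c' v} → Run k c (copies v) c' → c' [] ≡ c [] + k * loop v []
  root-after-copies {c} {c'} {v} run = begin
    c' []                 ≡⟨ +-identityʳ (c' []) ⟨
    c' [] + 0             ≡⟨ cong (c' [] +_) (*-zeroʳ (suc k)) ⟨
    c' [] + suc k * 0     ≡⟨ Run-conservation-at run (count-root-after-copies v) (inflow-root-after-copies v) ⟩
    c [] + k * loop v []  ∎
    where open ≡-Reasoning

  -- u ∷ʳ i is the vertex u of the copy of T_k hanging below the i-th child of the root.
  Replicates : ℕ → Config k → Config k → Set
  Replicates r cM cN = cN [] ≡ r × (∀ u i → cN (u ∷ʳ i) ≡ cM u)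

  copies-run : ∀ {r cM cN v} → Replicates r cM cN → suc k ≤ cM v → ∃ λ c' → Run k cN (copies v) c'
  copies-run {v = v} (_ , copy) ok =
    distinct-run (UniqueProperties.tabulate⁺ (∷ʳ-injectiveʳ v v))
                 (AllProperties.tabulate⁺ λ j → subst (suc k ≤_) (sym (copy v j)) ok)

  liftFiring-run : ∀ {r cM cN v} → 1 ≤ r → Replicates r cM cN → suc k ≤ cM v →
                   ∃ λ c' → Run k cN (liftFiring v) c'
  liftFiring-run {v = _ ∷ _} _ rep ok = copies-run rep ok
  liftFiring-run {r} {cN = cN} {v = []} 1≤r rep@(root , _) ok with copies-run rep ok
  ... | c₁ , run₁ = _ , run-++ run₁ (step root-ready done)
    where
    root-ready : suc k ≤ c₁ []
    root-ready = begin
      1 + k          ≤⟨ +-mono-≤ 1≤r (≤-reflexive (sym (*-identityʳ k))) ⟩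
      r + k * 1      ≡⟨ cong (_+ k * 1) root ⟨
      cN [] + k * 1  ≡⟨ root-after-copies run₁ ⟨
      c₁ []          ∎
      where open ≤-Reasoning

  liftFiring-Replicates : ∀ {r cM cN cN' v} → Replicates r cM cN → suc k ≤ cM v →
                          Run k cN (liftFiring v) cN' → Replicates r (fire k v cM) cN'
  liftFiring-Replicates {r} {cM} {cN} {cN'} {v} (root , copy) ok run = root′ , copy′
    where
    K = suc k
    root′ : cN' [] ≡ r
    root′ = +-cancelʳ-≡ (K * δ v []) (cN' []) r
      (trans (Run-conservation-at run (count-liftFiring-root v) (inflow-liftFiring-root v))
             (cong (_+ K * δ v []) root))
    copy′ : ∀ u i → cN' (u ∷ʳ i) ≡ fire k v cM u
    copy′ u i = +-cancelʳ-≡ (K * δ v u) (cN' (u ∷ʳ i)) (fire k v cM u) (begin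
      cN' (u ∷ʳ i) + K * δ v u   ≡⟨ Run-conservation-at run (count-liftFiring-∷ʳ v u i)
                                                              (inflow-liftFiring-∷ʳ v u i) ⟩
      cN (u ∷ʳ i) + edges v u    ≡⟨ cong (_+ edges v u) (copy u i) ⟩
      cM u + edges v u           ≡⟨ fire-balance v u ok ⟨
      fire k v cM u + K * δ v u  ∎)
      where open ≡-Reasoning

  simulate : ∀ {r cM cN vs dM} → 1 ≤ r → Replicates r cM cN → Run k cM vs dM →
             ∃₂ λ L dN → Run k cN L dN × Replicates r dM dN × count [] L ≡ count [] vs
  simulate _   rep done = [] , _ , done , rep , refl
  simulate 1≤r rep (step {v = v} ok run) with liftFiring-run 1≤r rep ok
  ... | cN₁ , run₁ with simulate 1≤r (liftFiring-Replicates rep ok run₁) run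
  ...   | L , dN , runL , repL , countL =
    liftFiring v ++ L , dN , run-++ run₁ runL , repL ,
    trans (sum-map-++ (λ x → δ x []) (liftFiring v) L) (cong₂ _+_ (count-liftFiring-root v) countL)

  Replicates-stable : ∀ {r dM dN} → r ≤ k → Replicates r dM dN → Stable k dM → Stable k dN
  Replicates-stable r≤k (root , copy) stable w with reverseView w
  ... | []          = subst (_< suc k) (sym root) (s≤s r≤k)
  ... | u ∶ _ ∶ʳ i  = subst (_< suc k) (sym (copy u i)) (stable u)

  initial-∷ʳ : ∀ {N} (u : Vertex k) i → initial k N (u ∷ʳ i) ≡ 0
  initial-∷ʳ []      i = refl
  initial-∷ʳ (_ ∷ _) i = refl

  initial≡*loop : ∀ N (u : Vertex k) → initial k N u ≡ N * loop [] u
  initial≡*loop N []      = sym (*-identityʳ N)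
  initial≡*loop N (_ ∷ _) = sym (*-zeroʳ N)

  after-root-firings : ∀ {r t c} → Run k (initial k (r + k * t)) (replicate t []) c →
                       Replicates r (initial k t) c
  after-root-firings {r} {t} {c} run = root , copy
    where
    K = suc k
    root : c [] ≡ r
    root = +-cancelʳ-≡ (K * t) (c []) r (begin
      c [] + K * t     ≡⟨ Run-conservation-at run (trans (sum-map-replicate _ t []) (*-identityʳ t))
                                                  (trans (sum-map-replicate _ t []) (*-identityʳ t)) ⟩
      (r + k * t) + t  ≡⟨ +-assoc r (k * t) t ⟩
      r + (k * t + t)  ≡⟨ cong (r +_) (+-comm (k * t) t) ⟩
      r + K * t        ∎)
      where open ≡-Reasoning
    copy : ∀ u i → c (u ∷ʳ i) ≡ initial k t u
    copy u i = +-cancelʳ-≡ 0 (c (u ∷ʳ i)) (initial k t u) (begin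
      c (u ∷ʳ i) + 0                                          ≡⟨ cong (c (u ∷ʳ i) +_) (*-zeroʳ K) ⟨
      c (u ∷ʳ i) + K * 0                                      ≡⟨ Run-conservation-at run count≡0 (sum-map-replicate _ t []) ⟩
      initial k (r + k * t) (u ∷ʳ i) + t * edges [] (u ∷ʳ i)  ≡⟨ cong₂ _+_ (initial-∷ʳ u i)
                                                                           (cong (t *_) (edges-root-∷ʳ u i)) ⟩
      t * loop [] u                                           ≡⟨ initial≡*loop t u ⟨
      initial k t u                                           ≡⟨ +-identityʳ _ ⟨
      initial k t u + 0                                       ∎)
      where
      open ≡-Reasoning
      count≡0 : count (u ∷ʳ i) (replicate t []) ≡ 0
      count≡0 = trans (sum-map-replicate _ t []) (trans (cong (t *_) (δ-≢ (∷ʳ≢[] u i ∘ sym))) (*-zeroʳ t))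

RootFirings-recurrence : ∀ {k r t b} → 1 ≤ r → r ≤ k → RootFirings k t b → RootFirings k (r + k * t) (t + b)
RootFirings-recurrence {k} {r} {t} 1≤r r≤k (ws , dM , runM , stableM , refl)
  with root-fires-repeatedly t (m<n+m (k * t) 1≤r)
... | c₀ , run₀ with simulate 1≤r (after-root-firings run₀) runM
...   | L , dN , runL , rep , countL =
  replicate t [] ++ L , dN , run-++ run₀ runL , Replicates-stable r≤k rep stableM , (begin
    rootCount (replicate t [] ++ L)         ≡⟨ rootCount≡count (replicate t [] ++ L) ⟩
    count [] (replicate t [] ++ L)          ≡⟨ sum-map-++ (λ x → δ x []) (replicate t []) L ⟩
    count [] (replicate t []) + count [] L  ≡⟨ cong₂ _+_ (trans (sum-map-replicate _ t []) (*-identityʳ t)) countL ⟩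
    t + count [] ws                         ≡⟨ cong (t +_) (rootCount≡count ws) ⟨
    t + rootCount ws                        ∎)
  where open ≡-Reasoning

⌈1+m/n⌉∸1≡m/n : ∀ m n → ⌈ suc m / suc n ⌉ ∸ 1 ≡ m / suc n
⌈1+m/n⌉∸1≡m/n m n = cong (_∸ 1) (begin
  (suc m + n) / suc n              ≡⟨ cong (_/ suc n) (+-suc m n) ⟨
  (m + suc n) / suc n              ≡⟨ m/n≡1+[m∸n]/n (m≤n+m (suc n) m) ⟩
  1 + (m + suc n ∸ suc n) / suc n  ≡⟨ cong (λ x → 1 + x / suc n) (m+n∸n≡m m (suc n)) ⟩
  1 + m / suc n                    ∎)
  where open ≡-Reasoning

mainTheorem7 : (k : ℕ) → 2 ≤ k → (N : ℕ) → 1 ≤ N →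
    (a b : ℕ) →
    RootFirings k N a →
    RootFirings k (⌈ N / k ⌉ ∸ 1) b →
    a ≡ (⌈ N / k ⌉ ∸ 1) + b
mainTheorem7 zero    ()
mainTheorem7 (suc k) _ (suc n) _ a b fN fM =
  RootFirings-unique fN (subst (λ N → RootFirings K N (t + b)) (sym N≡r+K*t)
                               (RootFirings-recurrence (s≤s z≤n) (m%n<n n K) fM))
  where
  K = suc k
  t = ⌈ suc n / K ⌉ ∸ 1
  N≡r+K*t : suc n ≡ suc (n % K) + K * t
  N≡r+K*t = begin
    suc n                      ≡⟨ cong suc (m≡m%n+[m/n]*n n K) ⟩
    suc (n % K + n / K * K)    ≡⟨ cong (λ x → suc (n % K + x)) (*-comm (n / K) K) ⟩
    suc (n % K) + K * (n / K)  ≡⟨ cong (λ x → suc (n % K) + K * x) (⌈1+m/n⌉∸1≡m/n n k) ⟨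
    suc (n % K) + K * t        ∎
    where open ≡-Reasoning
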